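{- Let $n\ge3$ and let $\mathcal H_n$ be the directed $n\times n$ grid with the monitor placement $\chi_{\mathtt g}$. Then $\mu(\mathcal H_n\mid\chi_{\mathtt g})\le 2$ under $\mathrm{CAP}^-$ and under $\mathrm{CSP}$.
   Context: $\mathcal H_n$ is the directed graph with vertex set $[n]^2=\{1,\dots,n\}^2$ and an edge from $(x_1,x_2)$ to $(y_1,y_2)$ iff for some $i\in\{1,2\}$, $y_i-x_i=1$ and the other coordinates agree. The monitor placement $\chi_{\mathtt g}=(\mathfrak m,\mathfrak M)$ has input nodes $\mathfrak m=\{(x_1,x_2): x_1=1\text{ or }x_2=1\}$ and output nodes $\mathfrak M=\{(x_1,x_2): x_1=n\text{ or }x_2=n\}$. The set of measurement paths $\mathbb P(G\mid\chi)$ (directed paths) depends on the routing mechanism: under $\mathrm{CSP}$ it consists of all simple directed paths from a node of $\mathfrak m$ to a different node of $\mathfrak M$; under $\mathrm{CAP}^-$ it consists of all directed walks starting in $\mathfrak m$ and ending in $\mathfrak M$, except single-node paths consisting of one node in $\mathfrak m\cap\mathfrak M$. For a node $v$, $\mathbb P(v)$ is the set of measurement paths through $v$, $\mathbb P(U)=\bigcup_{u\in U}\mathbb P(u)$. $V$ is $k$-identifiable if for all $U,W\subseteq V$ with $U\neq W$ and $|U|,|W|\le k$, $\mathbb P(U)\neq\mathbb P(W)$. $\mu(G\mid\chi)$ is the largest $k\ge0$ such that $V$ is $k$-identifiable. -}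

module Defs where

open import Data.Nat using (ℕ; zero; suc; _+_; _≤_; _∸_)
open import Data.Fin using (Fin; toℕ)
open import Data.Product using (_×_; _,_; ∃; ∃-syntax; Σ-syntax)
open import Data.Sum using (_⊎_)
open import Data.List using (List; []; _∷_; length)
open import Data.List.Membership.Propositional using (_∈_)
open import Data.List.Relation.Unary.Linked using (Linked)
open import Data.List.Relation.Unary.Unique.Propositional using (Unique)
open import Relation.Binary.PropositionalEquality using (_≡_; _≢_)
open import Relation.Nullary using (¬_)
open import Function.Bundles using (_⇔_)

-- Vertices of the n × n grid. Coordinates are 0-based: Fin n stands for
-- {1,…,n} via i ↦ toℕ i + 1.
Vertex : ℕ → Set
Vertex n = Fin n × Fin n

Edge : (n : ℕ) → Vertex n → Vertex n → Set
Edge n (x₁ , x₂) (y₁ , y₂) =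
  (toℕ y₁ ≡ suc (toℕ x₁) × x₂ ≡ y₂) ⊎ (toℕ y₂ ≡ suc (toℕ x₂) × x₁ ≡ y₁)

Input : (n : ℕ) → Vertex n → Set
Input n (x₁ , x₂) = toℕ x₁ ≡ 0 ⊎ toℕ x₂ ≡ 0

Output : (n : ℕ) → Vertex n → Set
Output n (x₁ , x₂) = toℕ x₁ ≡ n ∸ 1 ⊎ toℕ x₂ ≡ n ∸ 1

lastOf : {A : Set} → A → List A → A
lastOf v []       = v
lastOf v (w ∷ ws) = lastOf w ws

CAPminus : (n : ℕ) → List (Vertex n) → Set
CAPminus n p = ∃[ v ] ∃[ vs ]
  (p ≡ v ∷ vs × Linked (Edge n) p × Input n v × Output n (lastOf v vs)
   × ¬ (vs ≡ [] × Input n v × Output n v))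

CSP : (n : ℕ) → List (Vertex n) → Set
CSP n p = ∃[ v ] ∃[ vs ]
  (p ≡ v ∷ vs × Linked (Edge n) p × Unique p × Input n v × Output n (lastOf v vs)
   × v ≢ lastOf v vs)

-- A routing mechanism = its set of measurement paths (as a predicate on lists of vertices).
Routing : ℕ → Set₁
Routing n = List (Vertex n) → Set

PathsThrough : {n : ℕ} → Routing n → List (Vertex n) → List (Vertex n) → Set
PathsThrough R U p = R p × (∃[ u ] (u ∈ U × u ∈ p))

-- Finite node sets U ⊆ V are represented by lists; |U| ≤ k iff U is the
-- set of elements of some list of length ≤ k. Set equality is extensional.
SameSet : {A : Set} → List A → List A → Set
SameSet U W = ∀ x → (x ∈ U) ⇔ (x ∈ W)

Identifiable : {n : ℕ} → Routing n → ℕ → Set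
Identifiable {n} R k =
  (U W : List (Vertex n)) → length U ≤ k → length W ≤ k →
  ¬ SameSet U W →
  ¬ (∀ p → PathsThrough R U p ⇔ PathsThrough R W p)

module Submission where

-- Idea: ℙ does not change when the origin (1,1) is added to the node set
-- {(2,1),(1,2)}.  The origin is not an output node, so a measurement path
-- through it must leave it along an edge, and the only out-neighbours of
-- the origin are (2,1) and (1,2); hence ℙ(origin) ⊆ ℙ({(2,1),(1,2)}).  The
-- sets {(1,1),(2,1),(1,2)} and {(2,1),(1,2)} are distinct, of sizes 3 and 2,
-- with equal ℙ, so no k ≥ 3 admits k-identifiability.
--
-- Everything holds already for n ≥ 2.

open import Defs
open import Data.Nat using (ℕ; suc; _≤_; _<_; _<?_; s≤s; z≤n)
open import Data.Nat.Properties using (≮⇒≥; ≤-trans; ≤-pred; n≤1+n)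
open import Data.Fin using (Fin; toℕ) renaming (zero to fzero; suc to fsuc)
open import Data.Product using (_×_; _,_; ∃-syntax)
open import Data.Sum using (_⊎_; inj₁; inj₂)
open import Data.List using (List; []; _∷_; length)
open import Data.List.Relation.Unary.Any using (here; there)
open import Data.List.Membership.Propositional using (_∈_)
open import Data.List.Relation.Unary.Linked using (Linked; _∷_)
open import Relation.Binary.PropositionalEquality using (_≡_; refl)
open import Relation.Nullary using (¬_; yes; no)
open import Data.Empty using (⊥-elim)
open import Function.Bundles using (_⇔_; mk⇔; Equivalence)

indistinguishable⇒bound : {n : ℕ} (R : Routing n) (U W : List (Vertex n)) →
  length W ≤ length U → ¬ SameSet U W →
  (∀ p → PathsThrough R U p ⇔ PathsThrough R W p) →
  (k : ℕ) → Identifiable R k → k < length U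
indistinguishable⇒bound R U W W≤U U≢W sameℙ k identifiable with k <? length U
... | yes k<U = k<U
... | no  k≮U = ⊥-elim (identifiable U W U≤k (≤-trans W≤U U≤k) U≢W sameℙ)
  where U≤k = ≮⇒≥ k≮U

absorb : {n : ℕ} (R : Routing n) (z : Vertex n) (W : List (Vertex n)) →
  (∀ p → R p → z ∈ p → ∃[ w ] (w ∈ W × w ∈ p)) →
  ∀ p → PathsThrough R (z ∷ W) p ⇔ PathsThrough R W p
absorb R z W meetsW p = mk⇔ to from
  where
  to : PathsThrough R (z ∷ W) p → PathsThrough R W p
  to (r , _ , here refl , z∈p) = r , meetsW p r z∈p
  to (r , u , there u∈W , u∈p) = r , u , u∈W , u∈p

  from : PathsThrough R W p → PathsThrough R (z ∷ W) p
  from (r , u , u∈W , u∈p) = r , u , there u∈W , u∈p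

visits-successor : {A : Set} {E : A → A → Set} {Out : A → Set} {z : A} →
  ¬ Out z → (v : A) (vs : List A) → Linked E (v ∷ vs) →
  Out (lastOf v vs) → z ∈ v ∷ vs → ∃[ w ] (E z w × w ∈ v ∷ vs)
visits-successor ¬out v []       _       out (here refl) = ⊥-elim (¬out out)
visits-successor ¬out v (w ∷ ws) (e ∷ _) _   (here refl) = w , e , there (here refl)
visits-successor ¬out v (w ∷ ws) (_ ∷ l) out (there z∈)
  with visits-successor ¬out w ws l out z∈
... | s , e , s∈ = s , e , there s∈

EndsInOutput : {n : ℕ} → Routing n → Set
EndsInOutput {n} R = ∀ p → R p →
  ∃[ v ] ∃[ vs ] (p ≡ v ∷ vs × Linked (Edge n) p × Output n (lastOf v vs))

cap⁻-endsInOutput : {n : ℕ} → EndsInOutput (CAPminus n)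
cap⁻-endsInOutput p (v , vs , p≡ , walk , _ , out , _) = v , vs , p≡ , walk , out

csp-endsInOutput : {n : ℕ} → EndsInOutput (CSP n)
csp-endsInOutput p (v , vs , p≡ , walk , _ , _ , out , _) = v , vs , p≡ , walk , out

-- The grid H_n for n = m + 2, where the origin (1,1) and its neighbours
-- (2,1) and (1,2) exist and the origin is not an output node.
module Origin (m : ℕ) where
  n : ℕ
  n = suc (suc m)

  origin right up : Vertex n
  origin = fzero , fzero
  right  = fsuc fzero , fzero
  up     = fzero , fsuc fzero

  neighbours : List (Vertex n)
  neighbours = right ∷ up ∷ []

  toℕ≡1 : (i : Fin n) → toℕ i ≡ 1 → i ≡ fsuc fzero
  toℕ≡1 (fsuc fzero) refl = refl

  origin-successor : (w : Vertex n) → Edge n origin w → w ∈ neighbours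
  origin-successor (i , .fzero) (inj₁ (i≡1 , refl)) with toℕ≡1 i i≡1
  ... | refl = here refl
  origin-successor (.fzero , j) (inj₂ (j≡1 , refl)) with toℕ≡1 j j≡1
  ... | refl = there (here refl)

  origin-not-output : ¬ Output n origin
  origin-not-output (inj₁ ())
  origin-not-output (inj₂ ())

  origin-meets-neighbours : (R : Routing n) → EndsInOutput R →
    ∀ p → R p → origin ∈ p → ∃[ w ] (w ∈ neighbours × w ∈ p)
  origin-meets-neighbours R ends p r origin∈p with ends p r
  ... | v , vs , refl , walk , out
    with visits-successor {Out = Output n} origin-not-output v vs walk out origin∈p
  ... | w , e , w∈p = w , origin-successor w e , w∈p

  origin∉neighbours : ¬ origin ∈ neighbours
  origin∉neighbours (here ())
  origin∉neighbours (there (here ()))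

  μ≤2 : (R : Routing n) → EndsInOutput R → (k : ℕ) → Identifiable R k → k ≤ 2
  μ≤2 R ends k identifiable = ≤-pred
    (indistinguishable⇒bound R (origin ∷ neighbours) neighbours
      (n≤1+n 2) distinct
      (absorb R origin neighbours (origin-meets-neighbours R ends))
      k identifiable)
    where
    distinct : ¬ SameSet (origin ∷ neighbours) neighbours
    distinct same = origin∉neighbours (Equivalence.to (same origin) (here refl))

lemma3 : (n : ℕ) → 3 ≤ n → (k : ℕ) →
    (Identifiable (CAPminus n) k → k ≤ 2) × (Identifiable (CSP n) k → k ≤ 2)
lemma3 (suc (suc (suc m))) (s≤s (s≤s (s≤s z≤n))) k =
  μ≤2 (CAPminus _) cap⁻-endsInOutput k , μ≤2 (CSP _) csp-endsInOutput k
  where open Origin (suc m)
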